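{- Let $T$ be a tree with at least three vertices and let $u \to v$ be Player 1's first move in Trail Trap on $T$. If $v$ is not a central vertex of $T$ of degree $3$, then Player 2 has a winning strategy (against this first move). Furthermore, if $u$ and $v$ are both central vertices of $T$ and $\deg(u) \neq 2$, then Player 2 has a winning strategy (against this first move).
   Context: Trail Trap on a finite simple undirected graph $G$: Player 1 (P1) chooses a vertex, places a token on it and moves it along an incident edge $e$ to the other endpoint (a move $u\to v$ along edge $uv$). Player 2 (P2) then places their own token on any vertex and moves it along an incident edge $f \neq e$. Thereafter the players alternate, starting with P1, each moving their own token from its current vertex along an unused edge (an edge not previously traversed, in either direction, by either player) to the adjacent vertex; vertices may be revisited and the two tokens may share a vertex. The first player unable to move loses. The eccentricity of a vertex $v$ is $\max_{x} d(v,x)$; a central vertex is a vertex of minimum eccentricity. -}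

module Defs where

open import Data.Nat using (ℕ; zero; suc; _≤_)
open import Data.Fin using (Fin)
open import Data.Bool using (Bool; true; false; if_then_else_)
open import Data.List using (List; []; _∷_; _++_; map; allFin)
open import Data.Nat.ListAction using (sum)
open import Data.List.Relation.Unary.Any using (Any)
open import Data.List.Relation.Unary.Unique.Propositional using (Unique)
open import Data.Product using (Σ; ∃; ∃-syntax; _×_; _,_; proj₁; proj₂)
open import Data.Sum using (_⊎_)
open import Data.Unit using (⊤)
open import Relation.Nullary using (¬_)
open import Relation.Binary.PropositionalEquality using (_≡_)

record Graph (n : ℕ) : Set where
  field
    adj    : Fin n → Fin n → Bool
    sym    : ∀ u v → adj u v ≡ adj v u
    irrefl : ∀ v → adj v v ≡ false
open Graph public

module _ {n : ℕ} (G : Graph n) where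

  Adj : Fin n → Fin n → Set
  Adj u v = adj G u v ≡ true

  deg : Fin n → ℕ
  deg v = sum (map (λ w → if adj G v w then 1 else 0) (allFin n))

  data Walk : Fin n → Fin n → ℕ → Set where
    here : ∀ {v} → Walk v v 0
    step : ∀ {u w v k} → Adj u w → Walk w v k → Walk u v (suc k)

  Connected : Set
  Connected = ∀ u v → ∃[ k ] Walk u v k

  Chain : List (Fin n) → Set
  Chain []           = ⊤
  Chain (x ∷ [])     = ⊤
  Chain (x ∷ y ∷ xs) = Adj x y × Chain (y ∷ xs)

  HasCycle : Set
  HasCycle = Σ (Fin n) λ x → Σ (Fin n) λ y → Σ (List (Fin n)) λ ms → Σ (Fin n) λ z →
    Unique (x ∷ y ∷ ms ++ z ∷ []) × Chain (x ∷ y ∷ ms ++ z ∷ []) × Adj z x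

  IsTree : Set
  IsTree = Connected × ¬ HasCycle

  Dist : Fin n → Fin n → ℕ → Set
  Dist u v k = Walk u v k × (∀ j → Walk u v j → k ≤ j)

  Ecc : Fin n → ℕ → Set
  Ecc v e = (∀ x → ∃[ k ] (Dist v x k × k ≤ e)) × (∃[ x ] Dist v x e)

  Central : Fin n → Set
  Central v = ∃[ e ] (Ecc v e × (∀ w e′ → Ecc w e′ → e ≤ e′))

  -- Trail Trap. Used edges: list of traversed (oriented) pairs; an edge is
  -- used if traversed in either direction.
  Used : List (Fin n × Fin n) → Fin n → Fin n → Set
  Used E a b = Any (λ p → (proj₁ p ≡ a × proj₂ p ≡ b) ⊎ (proj₁ p ≡ b × proj₂ p ≡ a)) E

  -- Positions: used edges E, P1 token at a, P2 token at b.
  -- P2WinsP1Turn E a b : P1 to move, P2 has a winning strategy.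
  -- P2WinsP2Turn E a b : P2 to move, P2 has a winning strategy.
  data P2WinsP1Turn (E : List (Fin n × Fin n)) (a b : Fin n) : Set
  data P2WinsP2Turn (E : List (Fin n × Fin n)) (a b : Fin n) : Set

  data P2WinsP1Turn E a b where
    p1moves : (∀ a′ → Adj a a′ → ¬ Used E a a′ → P2WinsP2Turn ((a , a′) ∷ E) a′ b)
            → P2WinsP1Turn E a b

  data P2WinsP2Turn E a b where
    p2move : ∀ b′ → Adj b b′ → ¬ Used E b b′ → P2WinsP1Turn ((b , b′) ∷ E) a b′
           → P2WinsP2Turn E a b

  -- P2 has a winning strategy against P1's first move u → v:
  -- P2 places its token at w and moves along an edge ww′ different from uv,
  -- reaching a position (P1 to move) that P2 wins.
  P2WinsAgainst : Fin n → Fin n → Set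
  P2WinsAgainst u v = Σ (Fin n) λ w → Σ (Fin n) λ w′ →
    Adj w w′ × ¬ Used ((u , v) ∷ []) w w′ × P2WinsP1Turn ((w , w′) ∷ (u , v) ∷ []) v w′

-- Root the tree at v and let height y be the length of a longest downward path from y.
-- Once P1 has stepped from v into a branch y ≠ u, every unused edge at its token leads
-- downward, so P1 can move at most height y more times; P2, sitting on top of a disjoint
-- untouched subtree, wins this race as soon as its own downward path is at least as long.
-- With y₁ a tallest branch of v other than u, P2 opens with v → y₁ when y₁ is strictly
-- tallest, and with y₃ → v when v has a third branch besides u, y₁ and a second tallest
-- y₂ (then P2 follows into whichever of y₁, y₂ P1 avoided). If v is a leaf P1 is stuck at
-- once. What remains is v having exactly the branches u, y₁, y₂ with equal heights;
-- then P2 opens inside the branch of u, which wins if height u ≥ height y₁ + 2, or if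
-- height u ≥ height y₁ + 1 and u has two children. Otherwise v is central of degree 3,
-- respectively u is not central or has degree 2.

module Submission where

open import Defs hiding (sym)
open import Data.Nat using (ℕ; zero; suc; _≤_; _<_; _+_; _⊔_; z≤n; s≤s; _≤?_; _≟_)
open import Data.Nat.Properties
open import Data.Nat.Induction using (<-rec)
open import Data.Nat.ListAction using (sum)
open import Data.Fin as Fin using (Fin; punchIn; punchOut) renaming (_≟_ to _≟ᶠ_)
open import Data.Fin.Properties using (any?; punchInᵢ≢i; punchIn-injective; punchIn-punchOut)
open import Data.Bool using (Bool; true; false; if_then_else_)
open import Data.Bool.Properties using () renaming (_≟_ to _≟ᵇ_)
open import Data.List using (List; []; _∷_; _++_; [_]; map; allFin; filter; length)
open import Data.List.Extrema.Nat using (argmax; argmax-all; f[xs]≤f[argmax])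
open import Data.List.Membership.Propositional using (_∈_)
open import Data.List.Membership.Propositional.Properties using (∈-allFin; ∈-filter⁺)
open import Data.List.Relation.Unary.All as All using (All; []; _∷_)
open import Data.List.Relation.Unary.All.Properties using (all-filter; ∷ʳ⁺)
open import Data.List.Relation.Unary.Any as Any using (here; there)
open import Data.List.Relation.Unary.AllPairs using ([]; _∷_)
import Data.List.Relation.Unary.AllPairs.Properties as AllPairs
open import Data.List.Relation.Unary.Unique.Propositional using (Unique)
open import Data.List.Relation.Unary.Unique.Propositional.Properties using (allFin⁺)
open import Data.Product using (Σ-syntax; ∃; ∃-syntax; _×_; _,_; proj₁; proj₂)
open import Data.Sum as Sum using (_⊎_; inj₁; inj₂; [_,_]′)
open import Data.Empty using (⊥; ⊥-elim)
open import Data.Unit using (⊤; tt)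
open import Function using (id; _∘_)
open import Relation.Nullary using (¬_; Dec; yes; no; does)
open import Relation.Nullary.Decidable using (_×-dec_; ¬?)
open import Relation.Unary using (Decidable)
open import Relation.Binary.PropositionalEquality
  using (_≡_; _≢_; refl; sym; trans; cong; cong₂; subst; ≢-sym; module ≡-Reasoning)

Minimum : (ℕ → Set) → ℕ → Set
Minimum P m = P m × (∀ j → P j → m ≤ j)

Maximum : (ℕ → Set) → ℕ → Set
Maximum P m = P m × (∀ j → P j → j ≤ m)

opaque
  minimum : ∀ {P} → Decidable P → ∀ k → P k → ∃ (Minimum P)
  minimum {P} P? = <-rec (λ k → P k → ∃ (Minimum P)) search
    where
    search : ∀ k → (∀ {j} → j < k → P j → ∃ (Minimum P)) → P k → ∃ (Minimum P)
    search k smaller pk with anyUpTo? P? k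
    ... | yes (j , j<k , pj) = smaller j<k pj
    ... | no none = k , pk , λ j pj → ≮⇒≥ λ j<k → none (j , j<k , pj)

opaque
  maximum : ∀ {P} → Decidable P → ∀ bound → P 0 → (∀ k → P k → k ≤ bound) → ∃ (Maximum P)
  maximum P? bound p₀ bounded with P? bound
  ... | yes pb = bound , pb , bounded
  maximum P? zero p₀ bounded | no ¬p₀ = ⊥-elim (¬p₀ p₀)
  maximum P? (suc bound) p₀ bounded | no ¬pb =
    maximum P? bound p₀ λ k pk → ≤-pred (≤∧≢⇒< (bounded k pk) λ { refl → ¬pb pk })

opaque
  argmax-Fin : ∀ {m} {Q : Fin m → Set} → Decidable Q → (f : Fin m → ℕ) → ∀ {y₀} → Q y₀ →
               Σ[ y ∈ Fin m ] Q y × (∀ y′ → Q y′ → f y′ ≤ f y)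
  argmax-Fin {m} Q? f {y₀} q₀ =
    argmax f y₀ candidates ,
    argmax-all f q₀ (all-filter Q? (allFin m)) ,
    λ y′ q → All.lookup (f[xs]≤f[argmax] y₀ candidates) (∈-filter⁺ Q? (∈-allFin y′) q)
    where
    candidates : List (Fin m)
    candidates = filter Q? (allFin m)

Unique-∷ʳ : ∀ {A : Set} {xs : List A} {z} → Unique xs → All (_≢ z) xs → Unique (xs ++ [ z ])
Unique-∷ʳ unique ≢z = AllPairs.++⁺ unique ([] ∷ []) (All.map (_∷ []) ≢z)

exists-other : ∀ {k} (i : Fin (suc (suc k))) → ∃ (_≢ i)
exists-other Fin.zero = Fin.suc Fin.zero , λ ()
exists-other (Fin.suc i) = Fin.zero , λ ()

avoid-two : ∀ {n} → 3 ≤ n → (u v : Fin n) → ∃ λ z → z ≢ u × z ≢ v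
avoid-two (s≤s (s≤s (s≤s _))) u v with u ≟ᶠ v
... | yes refl = punchIn u Fin.zero , punchInᵢ≢i u Fin.zero , punchInᵢ≢i u Fin.zero
... | no u≢v with exists-other (punchOut u≢v)
...   | j , j≢ = punchIn u j , punchInᵢ≢i u j ,
                 λ eq → j≢ (punchIn-injective u j _ (trans eq (sym (punchIn-punchOut u≢v))))

count : ∀ {m} → (Fin m → Bool) → List (Fin m) → ℕ
count f xs = sum (map (λ w → if f w then 1 else 0) xs)

erase : ∀ {m} → Fin m → (Fin m → Bool) → Fin m → Bool
erase a f i = if does (i ≟ᶠ a) then false else f i

module _ {m : ℕ} (f : Fin m → Bool) where

  erase-self : ∀ a → erase a f a ≡ false
  erase-self a with a ≟ᶠ a
  ... | yes _ = refl
  ... | no a≢a = ⊥-elim (a≢a refl)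

  erase-other : ∀ {a i} → i ≢ a → erase a f i ≡ f i
  erase-other {a} {i} i≢a with i ≟ᶠ a
  ... | yes i≡a = ⊥-elim (i≢a i≡a)
  ... | no _ = refl

  erase-true : ∀ {a i} → erase a f i ≡ true → i ≢ a × f i ≡ true
  erase-true {a} {i} eq with i ≟ᶠ a
  erase-true () | yes _
  ... | no i≢a = i≢a , eq

  count-none : ∀ {xs} → All (λ i → f i ≢ true) xs → count f xs ≡ 0
  count-none [] = refl
  count-none {x ∷ _} (fx≢true ∷ rest) with f x
  ... | true = ⊥-elim (fx≢true refl)
  ... | false = count-none rest

  count-cong : ∀ {g xs} → All (λ i → f i ≡ g i) xs → count f xs ≡ count g xs
  count-cong [] = refl
  count-cong (fx≡gx ∷ rest) = cong₂ _+_ (cong (λ b → if b then 1 else 0) fx≡gx) (count-cong rest)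

  count-erase : ∀ {a xs} → Unique xs → a ∈ xs → f a ≡ true → count f xs ≡ suc (count (erase a f) xs)
  count-erase {a} (a∉xs ∷ _) (here refl) fa rewrite erase-self a | fa =
    cong suc (count-cong (All.map (λ a≢i → sym (erase-other (≢-sym a≢i))) a∉xs))
  count-erase {a} {x ∷ xs} (x∉xs ∷ unique) (there a∈xs) fa = begin
    (if f x then 1 else 0) + count f xs
      ≡⟨ cong₂ _+_ (cong (λ b → if b then 1 else 0) (sym (erase-other x≢a)))
                   (count-erase unique a∈xs fa) ⟩
    (if erase a f x then 1 else 0) + suc (count (erase a f) xs)
      ≡⟨ +-suc _ _ ⟩
    suc (count (erase a f) (x ∷ xs)) ∎
    where
    open ≡-Reasoning
    x≢a : x ≢ a
    x≢a = All.lookup x∉xs a∈xs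

count-allFin≡length : ∀ {m} (f : Fin m → Bool) {ns} → Unique ns → All (λ i → f i ≡ true) ns →
                      (∀ i → f i ≡ true → i ∈ ns) → count f (allFin m) ≡ length ns
count-allFin≡length {m} f {[]} _ _ complete =
  count-none f {allFin m} (All.tabulate λ {i} _ fi → case-empty (complete i fi))
  where
  case-empty : ∀ {i} → i ∈ [] → ⊥
  case-empty ()
count-allFin≡length {m} f {a ∷ ns} (a∉ns ∷ unique) (fa ∷ true-ns) complete =
  trans (count-erase f (allFin⁺ m) (∈-allFin a) fa)
        (cong suc (count-allFin≡length (erase a f) unique
                     (All.zipWith (λ (a≢i , fi) → trans (erase-other f (≢-sym a≢i)) fi) (a∉ns , true-ns))
                     complete′))
  where
  complete′ : ∀ i → erase a f i ≡ true → i ∈ ns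
  complete′ i eq with erase-true f eq
  ... | i≢a , fi with complete i fi
  ...   | here i≡a = ⊥-elim (i≢a i≡a)
  ...   | there i∈ns = i∈ns

module GraphProperties {n : ℕ} (G : Graph n) where

  Adj? : ∀ a b → Dec (Adj G a b)
  Adj? a b = adj G a b ≟ᵇ true

  Adj-sym : ∀ {a b} → Adj G a b → Adj G b a
  Adj-sym {a} {b} a~b = trans (Graph.sym G b a) a~b

  Adj⇒≢ : ∀ {a b} → Adj G a b → a ≢ b
  Adj⇒≢ {a} a~a refl with trans (sym a~a) (irrefl G a)
  ... | ()

  deg≡length : ∀ {v ns} → Unique ns → All (Adj G v) ns → (∀ w → Adj G v w → w ∈ ns) →
               deg G v ≡ length ns
  deg≡length {v} = count-allFin≡length (adj G v)

  Walk? : ∀ k a b → Dec (Walk G a b k)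
  Walk? zero a b with a ≟ᶠ b
  ... | yes refl = yes here
  ... | no a≢b = no λ { here → a≢b refl }
  Walk? (suc k) a b with any? (λ w → Adj? a w ×-dec Walk? k w b)
  ... | yes (_ , a~w , walk) = yes (step a~w walk)
  ... | no none = no λ { (step a~w walk) → none (_ , a~w , walk) }

  Walk-∷ʳ : ∀ {a b c k} → Walk G a b k → Adj G b c → Walk G a c (suc k)
  Walk-∷ʳ here b~c = step b~c here
  Walk-∷ʳ (step a~w walk) b~c = step a~w (Walk-∷ʳ walk b~c)

  Walk-unsnoc : ∀ {a b k} → Walk G a b (suc k) → Σ[ p ∈ Fin n ] Walk G a p k × Adj G p b
  Walk-unsnoc (step a~b here) = _ , here , a~b
  Walk-unsnoc (step a~w walk@(step _ _)) with Walk-unsnoc walk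
  ... | p , walk′ , p~b = p , step a~w walk′ , p~b

  Chain-∷ʳ : ∀ x xs {y z} → Chain G (x ∷ xs ++ [ y ]) → Adj G y z →
             Chain G (x ∷ (xs ++ [ y ]) ++ [ z ])
  Chain-∷ʳ x [] (x~y , _) y~z = x~y , y~z , tt
  Chain-∷ʳ x (w ∷ xs) (x~w , chain) y~z = x~w , Chain-∷ʳ w xs chain y~z

  Used-sym : ∀ {E x y} → Used G E x y → Used G E y x
  Used-sym = Any.map Sum.swap

  Avoids : Fin n → List (Fin n × Fin n) → Set
  Avoids x = All λ e → x ≢ proj₁ e × x ≢ proj₂ e

  avoids⇒unusedʳ : ∀ {E x y} → Avoids y E → ¬ Used G E x y
  avoids⇒unusedʳ ((_ , y≢q) ∷ _) (here (inj₁ (_ , q≡y))) = y≢q (sym q≡y)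
  avoids⇒unusedʳ ((y≢p , _) ∷ _) (here (inj₂ (p≡y , _))) = y≢p (sym p≡y)
  avoids⇒unusedʳ (_ ∷ avoids) (there used) = avoids⇒unusedʳ avoids used

  avoids⇒unusedˡ : ∀ {E x y} → Avoids x E → ¬ Used G E x y
  avoids⇒unusedˡ avoids used = avoids⇒unusedʳ avoids (Used-sym used)

  ecc-≥ : ∀ {w e m} → Ecc G w e → ∀ z → (∀ {k} → Walk G w z k → m ≤ k) → m ≤ e
  ecc-≥ (reach , _) z bound with reach z
  ... | _ , (walk , _) , k≤e = ≤-trans (bound walk) k≤e

module RootedTree {n : ℕ} (G : Graph n) (tree : IsTree G) (r : Fin n) where
  open GraphProperties G

  private
    nearest : ∀ x → ∃ (Dist G r x)
    nearest x = minimum (λ k → Walk? k r x) (proj₁ (proj₁ tree r x)) (proj₂ (proj₁ tree r x))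

  depth : Fin n → ℕ
  depth x = proj₁ (nearest x)

  depth-dist : ∀ x → Dist G r x (depth x)
  depth-dist x = proj₂ (nearest x)

  depth-walk : ∀ x → Walk G r x (depth x)
  depth-walk x = proj₁ (depth-dist x)

  depth-minimal : ∀ {x k} → Walk G r x k → depth x ≤ k
  depth-minimal {x} = proj₂ (depth-dist x) _

  dist⇒depth : ∀ {x k} → Dist G r x k → k ≡ depth x
  dist⇒depth {x} (walk , minimal) = ≤-antisym (minimal _ (depth-walk x)) (depth-minimal walk)

  depth-root : depth r ≡ 0
  depth-root = n≤0⇒n≡0 (depth-minimal here)

  depth≡0⇒root : ∀ {x} → depth x ≡ 0 → x ≡ r
  depth≡0⇒root {x} eq = empty-walk (subst (Walk G r x) eq (depth-walk x))
    where
    empty-walk : ∀ {a b} → Walk G a b 0 → b ≡ a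
    empty-walk here = refl

  depth-<⇒≢ : ∀ {x y} → depth x < depth y → x ≢ y
  depth-<⇒≢ lt refl = <-irrefl refl lt

  depth-step : ∀ {x y} → Adj G x y → depth y ≤ suc (depth x)
  depth-step {x} x~y = depth-minimal (Walk-∷ʳ (depth-walk x) x~y)

  depth-along-walk : ∀ {a b k} → Walk G a b k → depth b ≤ depth a + k
  depth-along-walk {a} here = m≤m+n (depth a) 0
  depth-along-walk {a} {b} (step {w = w} {k = k} a~w walk) = begin
    depth b          ≤⟨ depth-along-walk walk ⟩
    depth w + k      ≤⟨ +-monoˡ-≤ k (depth-step a~w) ⟩
    suc (depth a) + k ≡⟨ sym (+-suc (depth a) k) ⟩
    depth a + suc k  ∎
    where open ≤-Reasoning

  parent-exists : ∀ {x k} → depth x ≡ suc k → Σ[ p ∈ Fin n ] Adj G p x × depth p ≡ k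
  parent-exists {x} {k} eq with Walk-unsnoc (subst (Walk G r x) eq (depth-walk x))
  ... | p , walk , p~x =
    p , p~x , ≤-antisym (depth-minimal walk) (≤-pred (subst (_≤ suc (depth p)) eq (depth-step p~x)))

  -- Climb from a and b one level at a time; where their parents coincide, M closes a cycle.
  no-low-path : ∀ k {a b} M → depth a ≡ k → depth b ≡ k → a ≢ b →
                Unique (a ∷ M ++ [ b ]) → Chain G (a ∷ M ++ [ b ]) →
                All (λ w → k ≤ depth w) (a ∷ M ++ [ b ]) → ⊥
  no-low-path zero M da db a≢b _ _ _ = a≢b (trans (depth≡0⇒root da) (sym (depth≡0⇒root db)))
  no-low-path (suc k) {a} {b} M da db a≢b unique chain deep =
    climb (parent-exists da) (parent-exists db)
    where
    above : ∀ {p} → depth p ≡ k → All (p ≢_) (a ∷ M ++ [ b ])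
    above dp = All.map (λ {w} deep-w → depth-<⇒≢ (subst (_≤ depth w) (cong suc (sym dp)) deep-w)) deep

    climb : Σ[ p ∈ Fin n ] Adj G p a × depth p ≡ k → Σ[ q ∈ Fin n ] Adj G q b × depth q ≡ k → ⊥
    climb (p , p~a , dp) (q , q~b , dq) with p ≟ᶠ q
    ... | yes refl = proj₂ tree (p , a , M , b , above dp ∷ unique , (p~a , chain) , Adj-sym q~b)
    ... | no p≢q = no-low-path k (a ∷ M ++ [ b ]) dp dq p≢q
                     (∷ʳ⁺ (above dp) p≢q ∷ Unique-∷ʳ unique (All.map ≢-sym (above dq)))
                     (p~a , Chain-∷ʳ a M chain (Adj-sym q~b))
                     (≤-reflexive (sym dp)
                       ∷ ∷ʳ⁺ (All.map (≤-trans (n≤1+n k)) deep) (≤-reflexive (sym dq)))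

  adj⇒depth≢ : ∀ {a b} → Adj G a b → depth a ≢ depth b
  adj⇒depth≢ {a} a~b eq =
    no-low-path (depth a) [] refl (sym eq) (Adj⇒≢ a~b) ((Adj⇒≢ a~b ∷ []) ∷ [] ∷ []) (a~b , tt)
      (≤-refl ∷ ≤-reflexive eq ∷ [])

  Child : Fin n → Fin n → Set
  Child x c = Adj G x c × depth c ≡ suc (depth x)

  Child? : ∀ x c → Dec (Child x c)
  Child? x c = Adj? x c ×-dec (depth c ≟ suc (depth x))

  adj⇒child⊎parent : ∀ {x y} → Adj G x y → Child x y ⊎ Child y x
  adj⇒child⊎parent {x} {y} x~y
    with m≤n⇒m<n∨m≡n (depth-step x~y) | m≤n⇒m<n∨m≡n (depth-step (Adj-sym x~y))
  ... | inj₂ dy | _ = inj₁ (x~y , dy)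
  ... | inj₁ _ | inj₂ dx = inj₂ (Adj-sym x~y , dx)
  ... | inj₁ (s≤s y≤x) | inj₁ (s≤s x≤y) = ⊥-elim (adj⇒depth≢ x~y (≤-antisym x≤y y≤x))

  root-neighbour-child : ∀ {t} → Adj G r t → Child r t
  root-neighbour-child r~t with adj⇒child⊎parent r~t
  ... | inj₁ r→t = r→t
  ... | inj₂ (_ , dr) with trans (sym depth-root) dr
  ...   | ()

  root-neighbour-depth : ∀ {t} → Adj G r t → depth t ≡ 1
  root-neighbour-depth r~t = trans (proj₂ (root-neighbour-child r~t)) (cong suc depth-root)

  parent-unique : ∀ {p q x} → Child p x → Child q x → p ≡ q
  parent-unique {p} {q} {x} (p~x , dx) (q~x , dx′) with p ≟ᶠ q
  ... | yes p≡q = p≡q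
  ... | no p≢q = ⊥-elim (no-low-path (depth p) [ x ] refl dq p≢q
          ((Adj⇒≢ p~x ∷ p≢q ∷ []) ∷ (≢-sym (Adj⇒≢ q~x) ∷ []) ∷ [] ∷ [])
          (p~x , Adj-sym q~x , tt)
          (≤-refl ∷ ≤-trans (n≤1+n _) (≤-reflexive (sym dx)) ∷ ≤-reflexive (sym dq) ∷ []))
    where
    dq : depth q ≡ depth p
    dq = suc-injective (trans (sym dx′) dx)

  data DownWalk : Fin n → Fin n → ℕ → Set where
    [] : ∀ {x} → DownWalk x x 0
    _∷_ : ∀ {x c z k} → Child x c → DownWalk c z k → DownWalk x z (suc k)

  Descendant : Fin n → Fin n → Set
  Descendant t x = ∃[ k ] DownWalk t x k

  depth-downWalk : ∀ {t x k} → DownWalk t x k → depth x ≡ k + depth t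
  depth-downWalk [] = refl
  depth-downWalk {t} (_∷_ {k = k} (_ , dc) walk) =
    trans (depth-downWalk walk) (trans (cong (k +_) dc) (+-suc k (depth t)))

  DownWalk-∷ʳ : ∀ {t p x k} → DownWalk t p k → Child p x → DownWalk t x (suc k)
  DownWalk-∷ʳ [] p→x = p→x ∷ []
  DownWalk-∷ʳ (t→c ∷ walk) p→x = t→c ∷ DownWalk-∷ʳ walk p→x

  DownWalk-unsnoc : ∀ {t x k} → DownWalk t x (suc k) → Σ[ p ∈ Fin n ] DownWalk t p k × Child p x
  DownWalk-unsnoc (t→x ∷ []) = _ , [] , t→x
  DownWalk-unsnoc (t→c ∷ walk@(_ ∷ _)) with DownWalk-unsnoc walk
  ... | p , walk′ , p→x = p , t→c ∷ walk′ , p→x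

  downWalk-source-unique : ∀ k {y₁ y₂ x} → DownWalk y₁ x k → DownWalk y₂ x k → y₁ ≡ y₂
  downWalk-source-unique zero [] [] = refl
  downWalk-source-unique (suc k) walk₁ walk₂ with DownWalk-unsnoc walk₁ | DownWalk-unsnoc walk₂
  ... | _ , walk₁′ , p₁→x | _ , walk₂′ , p₂→x with parent-unique p₁→x p₂→x
  ...   | refl = downWalk-source-unique k walk₁′ walk₂′

  root-downWalk : ∀ x → DownWalk r x (depth x)
  root-downWalk x = go (depth x) refl
    where
    go : ∀ k {x} → depth x ≡ k → DownWalk r x k
    go zero dx rewrite depth≡0⇒root dx = []
    go (suc k) dx with parent-exists dx
    ... | p , p~x , dp = DownWalk-∷ʳ (go k dp) (p~x , trans dx (cong suc (sym dp)))

  descendant-refl : ∀ {t} → Descendant t t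
  descendant-refl = 0 , []

  child-descendant : ∀ {b c x} → Child b c → Descendant c x → Descendant b x
  child-descendant b→c (k , walk) = suc k , b→c ∷ walk

  descendant-∷ʳ : ∀ {t p x} → Descendant t p → Child p x → Descendant t x
  descendant-∷ʳ (k , walk) p→x = suc k , DownWalk-∷ʳ walk p→x

  descendant⇒depth-≤ : ∀ {t x} → Descendant t x → depth t ≤ depth x
  descendant⇒depth-≤ {t} (k , walk) = ≤-trans (m≤n+m (depth t) k) (≤-reflexive (sym (depth-downWalk walk)))

  shallower⇒¬descendant : ∀ {t x} → depth x < depth t → ¬ Descendant t x
  shallower⇒¬descendant x<t t→x = <⇒≱ x<t (descendant⇒depth-≤ t→x)

  ¬descendant⇒≢ : ∀ {t x} → ¬ Descendant t x → t ≢ x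
  ¬descendant⇒≢ x∉t refl = x∉t descendant-refl

  descendant-parent : ∀ {t p w} → Descendant t w → Child p w → w ≡ t ⊎ Descendant t p
  descendant-parent (zero , []) _ = inj₁ refl
  descendant-parent (suc k , walk) p→w with DownWalk-unsnoc walk
  ... | _ , walk′ , p′→w with parent-unique p→w p′→w
  ...   | refl = inj₂ (k , walk′)

  branch : ∀ x → x ≢ r → Σ[ t ∈ Fin n ] Adj G r t × Descendant t x
  branch x x≢r = first-step (root-downWalk x)
    where
    first-step : ∀ {k} → DownWalk r x k → Σ[ t ∈ Fin n ] Adj G r t × Descendant t x
    first-step [] = ⊥-elim (x≢r refl)
    first-step ((r~t , _) ∷ walk) = _ , r~t , (_ , walk)

  parent : ∀ x → x ≢ r → Σ[ p ∈ Fin n ] Child p x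
  parent x x≢r = last-step (root-downWalk x)
    where
    last-step : ∀ {k} → DownWalk r x k → Σ[ p ∈ Fin n ] Child p x
    last-step [] = ⊥-elim (x≢r refl)
    last-step walk@(_ ∷ _) with DownWalk-unsnoc walk
    ... | p , _ , p→x = p , p→x

  Disjoint : Fin n → Fin n → Set
  Disjoint a b = ∀ x → Descendant a x → Descendant b x → ⊥

  same-depth-disjoint : ∀ {y₁ y₂} → depth y₁ ≡ depth y₂ → y₁ ≢ y₂ → Disjoint y₁ y₂
  same-depth-disjoint {y₁} {y₂} d≡ y₁≢y₂ x (k₁ , walk₁) (k₂ , walk₂)
    with +-cancelʳ-≡ (depth y₁) k₁ k₂
           (trans (sym (depth-downWalk walk₁)) (trans (depth-downWalk walk₂) (cong (k₂ +_) (sym d≡))))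
  ... | refl = y₁≢y₂ (downWalk-source-unique k₁ walk₁ walk₂)

  root∉branch : ∀ {t} → Adj G r t → ¬ Descendant t r
  root∉branch r~t = shallower⇒¬descendant (≤-reflexive (sym (proj₂ (root-neighbour-child r~t))))

  branches-disjoint : ∀ {t₁ t₂} → Adj G r t₁ → Adj G r t₂ → t₁ ≢ t₂ → Disjoint t₁ t₂
  branches-disjoint r~t₁ r~t₂ =
    same-depth-disjoint (trans (root-neighbour-depth r~t₁) (sym (root-neighbour-depth r~t₂)))

  -- Leaving the branch below a neighbour t of the root forces a walk through the root.
  leave-branch : ∀ {t w z k} → Descendant t w → Adj G r t → ¬ Descendant t z → Walk G w z k →
                 depth w + depth z ≤ k
  leave-branch t→w _ z∉t here = ⊥-elim (z∉t t→w)
  leave-branch {t} {w} {z} t→w r~t z∉t (step {w = w′} {k = k} w~w′ walk)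
    with adj⇒child⊎parent w~w′
  ... | inj₁ w→w′@(_ , dw′) = m≤n⇒m≤1+n (begin
    depth w + depth z      ≤⟨ +-monoˡ-≤ (depth z) (n≤1+n (depth w)) ⟩
    suc (depth w) + depth z ≡⟨ cong (_+ depth z) (sym dw′) ⟩
    depth w′ + depth z     ≤⟨ leave-branch (descendant-∷ʳ t→w w→w′) r~t z∉t walk ⟩
    k                      ∎)
    where open ≤-Reasoning
  ... | inj₂ w′→w@(_ , dw) with descendant-parent t→w w′→w
  ...   | inj₁ refl = ≤-trans (≤-reflexive (cong (_+ depth z) (root-neighbour-depth r~t)))
                            (s≤s (≤-trans (depth-along-walk walk) (≤-reflexive (cong (_+ k) root-depth))))
    where
    root-depth : depth w′ ≡ 0
    root-depth = suc-injective (trans (sym dw) (root-neighbour-depth r~t))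
  ...   | inj₂ t→w′ = ≤-trans (≤-reflexive (cong (_+ depth z) dw))
                              (s≤s (leave-branch t→w′ r~t z∉t walk))

  private
    farthest : Σ[ x ∈ Fin n ] ⊤ × (∀ y → ⊤ → depth y ≤ depth x)
    farthest = argmax-Fin (λ _ → yes tt) depth {r} tt

  far : Fin n
  far = proj₁ farthest

  depth≤far : ∀ x → depth x ≤ depth far
  depth≤far x = proj₂ (proj₂ farthest) x tt

  Reaches : Fin n → ℕ → Set
  Reaches y k = ∃[ z ] DownWalk y z k

  reaches? : ∀ y → Decidable (Reaches y)
  reaches? y zero = yes (y , [])
  reaches? y (suc k) with any? (λ c → Child? y c ×-dec reaches? c k)
  ... | yes (_ , y→c , z , walk) = yes (z , y→c ∷ walk)
  ... | no none = no λ { (z , y→c ∷ walk) → none (_ , y→c , z , walk) }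

  private
    tallest : ∀ y → ∃ (Maximum (Reaches y))
    tallest y = maximum (reaches? y) (depth far) (y , []) λ k (z , walk) →
      ≤-trans (m≤m+n k (depth y)) (≤-trans (≤-reflexive (sym (depth-downWalk walk))) (depth≤far z))

  height : Fin n → ℕ
  height y = proj₁ (tallest y)

  height-reached : ∀ y → Reaches y (height y)
  height-reached y = proj₁ (proj₂ (tallest y))

  downWalk≤height : ∀ {y z k} → DownWalk y z k → k ≤ height y
  downWalk≤height {y} {z} {k} walk = proj₂ (proj₂ (tallest y)) k (z , walk)

  height-child : ∀ {a c} → Child a c → suc (height c) ≤ height a
  height-child {c = c} a→c with height-reached c
  ... | _ , walk = downWalk≤height (a→c ∷ walk)

  tallest-child : ∀ {m b} → suc m ≤ height b → Σ[ c ∈ Fin n ] Child b c × m ≤ height c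
  tallest-child {m} {b} m<b = first-step (proj₂ (height-reached b)) m<b
    where
    first-step : ∀ {z k} → DownWalk b z k → suc m ≤ k → Σ[ c ∈ Fin n ] Child b c × m ≤ height c
    first-step (b→c ∷ walk) (s≤s m≤k) = _ , b→c , ≤-trans m≤k (downWalk≤height walk)

  deepest-descendant : ∀ y → Σ[ z ∈ Fin n ] Descendant y z × depth z ≡ height y + depth y
  deepest-descendant y with height-reached y
  ... | z , walk = z , (_ , walk) , depth-downWalk walk

  descendant-depth≤ : ∀ {t x} → Descendant t x → depth x ≤ height t + depth t
  descendant-depth≤ {t} (k , walk) =
    ≤-trans (≤-reflexive (depth-downWalk walk)) (+-monoˡ-≤ (depth t) (downWalk≤height walk))

  height+depth-branch : ∀ {t} → Adj G r t → height t + depth t ≡ suc (height t)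
  height+depth-branch {t} r~t = trans (cong (height t +_) (root-neighbour-depth r~t)) (+-comm (height t) 1)

  deepest-in-branch : ∀ {t} → Adj G r t → Σ[ z ∈ Fin n ] Descendant t z × depth z ≡ suc (height t)
  deepest-in-branch {t} r~t with deepest-descendant t
  ... | z , t→z , dz = z , t→z , trans dz (height+depth-branch r~t)

  root-ecc : Ecc G r (depth far)
  root-ecc = (λ x → depth x , depth-dist x , depth≤far x) , far , depth-dist far

  root-ecc-≤ : ∀ {e m} → Ecc G r e → (∀ x → depth x ≤ m) → e ≤ m
  root-ecc-≤ (_ , x , dist) bound = ≤-trans (≤-reflexive (dist⇒depth dist)) (bound x)

  root-central : (∀ {t} → Adj G r t → Σ[ z ∈ Fin n ] ¬ Descendant t z × depth far ≤ suc (depth z)) →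
                 Central G r
  root-central escape = depth far , root-ecc , minimal
    where
    minimal : ∀ w e → Ecc G w e → depth far ≤ e
    minimal w e ecc with w ≟ᶠ r
    ... | yes refl = ecc-≥ ecc far depth-minimal
    ... | no w≢r with branch w w≢r
    ...   | t , r~t , t→w with escape r~t
    ...     | z , z∉t , far≤ = ecc-≥ ecc z λ walk → begin
      depth far         ≤⟨ far≤ ⟩
      1 + depth z       ≤⟨ +-monoˡ-≤ (depth z) 1≤w ⟩
      depth w + depth z ≤⟨ leave-branch t→w r~t z∉t walk ⟩
      _                 ∎
      where
      open ≤-Reasoning
      1≤w : 1 ≤ depth w
      1≤w = subst (_≤ depth w) (root-neighbour-depth r~t) (descendant⇒depth-≤ t→w)

  OnlyDown : List (Fin n × Fin n) → Fin n → Set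
  OnlyDown E a = ∀ a′ → Adj G a a′ → ¬ Used G E a a′ → Child a a′

  onlyDown-∷ : ∀ {E p x} → Child p x → OnlyDown ((p , x) ∷ E) x
  onlyDown-∷ p→x a′ x~a′ unused with adj⇒child⊎parent x~a′
  ... | inj₁ x→a′ = x→a′
  ... | inj₂ a′→x with parent-unique a′→x p→x
  ...   | refl = ⊥-elim (unused (here (inj₂ (refl , refl))))

  onlyDown-weaken : ∀ {E e a} → OnlyDown E a → OnlyDown (e ∷ E) a
  onlyDown-weaken down a′ a~a′ unused = down a′ a~a′ (λ used → unused (there used))

  Untouched : List (Fin n × Fin n) → Fin n → Set
  Untouched E b = All (λ e → ¬ Descendant b (proj₁ e) ⊎ ¬ Descendant b (proj₂ e)) E

  untouched⇒unused : ∀ {E b x y} → Untouched E b → Descendant b x → Descendant b y → ¬ Used G E x y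
  untouched⇒unused (outside ∷ _) b→x b→y (here (inj₁ (refl , refl))) =
    [ (λ x∉ → x∉ b→x) , (λ y∉ → y∉ b→y) ]′ outside
  untouched⇒unused (outside ∷ _) b→x b→y (here (inj₂ (refl , refl))) =
    [ (λ y∉ → y∉ b→y) , (λ x∉ → x∉ b→x) ]′ outside
  untouched⇒unused (_ ∷ untouched) b→x b→y (there used) = untouched⇒unused untouched b→x b→y used

  untouched-child : ∀ {E b c} → Child b c → Untouched E b → Untouched E c
  untouched-child b→c = All.map (Sum.map (λ x∉b c→x → x∉b (child-descendant b→c c→x))
                                         (λ y∉b c→y → y∉b (child-descendant b→c c→y)))

  -- P1 descends at most m more times; P2 follows a longest path down its untouched subtree.
  race-P1 : ∀ m {E a b} → OnlyDown E a → height a ≤ m → m ≤ height b → Disjoint a b →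
            Untouched E b → P2WinsP1Turn G E a b
  race-P2 : ∀ m {E a b} → OnlyDown E a → height a ≤ m → suc m ≤ height b → Disjoint a b →
            Untouched E b → P2WinsP2Turn G E a b

  race-P1 zero down a≤0 _ _ _ = p1moves λ a′ a~a′ unused →
    ⊥-elim (1+n≰n (≤-trans (≤-trans (height-child (down a′ a~a′ unused)) a≤0) z≤n))
  race-P1 (suc m) {a = a} down a≤ m≤b disjoint untouched = p1moves λ a′ a~a′ unused →
    let a→a′ = down a′ a~a′ unused in
    race-P2 m (onlyDown-∷ a→a′) (≤-pred (≤-trans (height-child a→a′) a≤)) m≤b
      (λ x a′→x b→x → disjoint x (child-descendant a→a′ a′→x) b→x)
      (inj₁ (disjoint a descendant-refl) ∷ untouched)

  race-P2 m down a≤ m<b disjoint untouched with tallest-child m<b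
  ... | c , b→c@(b~c , dc) , m≤c =
    p2move c b~c (untouched⇒unused untouched descendant-refl (child-descendant b→c descendant-refl))
      (race-P1 m (onlyDown-weaken down) a≤ m≤c
        (λ x a→x c→x → disjoint x a→x (child-descendant b→c c→x))
        (inj₁ (shallower⇒¬descendant (≤-reflexive (sym dc))) ∷ untouched-child b→c untouched))

module FirstMove {n : ℕ} (G : Graph n) (tree : IsTree G) {u v : Fin n} (u~v : Adj G u v) where
  open GraphProperties G
  open RootedTree G tree v

  u-depth : depth u ≡ 1
  u-depth = root-neighbour-depth (Adj-sym u~v)

  below-u : ∀ {c x} → Child u c → depth x ≤ 1 → ¬ Descendant c x
  below-u (_ , dc) dx =
    shallower⇒¬descendant (≤-trans (s≤s (≤-trans dx (≤-reflexive (sym u-depth)))) (≤-reflexive (sym dc)))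

  u∉below-u : ∀ {c} → Child u c → ¬ Descendant c u
  u∉below-u u→c = below-u u→c (≤-reflexive u-depth)

  v∉below-u : ∀ {c} → Child u c → ¬ Descendant c v
  v∉below-u u→c = below-u u→c (≤-trans (≤-reflexive depth-root) z≤n)

  branch-disjoint-below-u : ∀ {a′ c} → Adj G v a′ → a′ ≢ u → Child u c → Disjoint a′ c
  branch-disjoint-below-u v~a′ a′≢u u→c x a′→x c→x =
    branches-disjoint v~a′ (Adj-sym u~v) a′≢u x a′→x (child-descendant u→c c→x)

  Opening : Fin n → Fin n → List (Fin n × Fin n)
  Opening w w′ = (w , w′) ∷ (u , v) ∷ []

  reply≢u : ∀ {w w′ a′} → ¬ Used G (Opening w w′) v a′ → a′ ≢ u
  reply≢u unused refl = unused (there (here (inj₂ (refl , refl))))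

  Outrunning : Fin n → Fin n → Fin n → Set
  Outrunning w b a′ = suc (height a′) ≤ height b × Disjoint a′ b × Untouched ((v , a′) ∷ Opening w b) b

  Overtaking : Fin n → Fin n → Fin n → Set
  Overtaking w w′ a′ = Σ[ c ∈ Fin n ] Adj G w′ c × Avoids c ((v , a′) ∷ Opening w w′)
                                     × height a′ ≤ height c × Disjoint a′ c
                                     × Untouched ((w′ , c) ∷ (v , a′) ∷ Opening w w′) c

  outrun : ∀ {w b} → Adj G w b → ¬ Used G [ (u , v) ] w b →
           (∀ {a′} → Adj G v a′ → ¬ Used G (Opening w b) v a′ → Outrunning w b a′) →
           P2WinsAgainst G u v
  outrun {w} {b} w~b fresh reply = w , b , w~b , fresh , p1moves λ a′ v~a′ unused →
    let taller , disjoint , untouched = reply v~a′ unused in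
    race-P2 (height a′) (onlyDown-∷ (root-neighbour-child v~a′)) ≤-refl taller disjoint untouched

  overtake : ∀ {w w′} → Adj G w w′ → ¬ Used G [ (u , v) ] w w′ →
             (∀ {a′} → Adj G v a′ → ¬ Used G (Opening w w′) v a′ → Overtaking w w′ a′) →
             P2WinsAgainst G u v
  overtake {w} {w′} w~w′ fresh reply = w , w′ , w~w′ , fresh , p1moves λ a′ v~a′ unused →
    let c , w′~c , c-fresh , taller , disjoint , untouched = reply v~a′ unused in
    p2move c w′~c (avoids⇒unusedʳ c-fresh)
      (race-P1 (height a′) (onlyDown-weaken (onlyDown-∷ (root-neighbour-child v~a′))) ≤-refl
               taller disjoint untouched)

  leaf-root-wins : 3 ≤ n → ¬ (∃[ y ] Adj G v y × y ≢ u) → P2WinsAgainst G u v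
  leaf-root-wins 3≤n leaf with avoid-two 3≤n u v
  ... | z , z≢u , z≢v with parent z z≢v
  ...   | p , p~z , _ = p , z , p~z , avoids⇒unusedʳ ((z≢u , z≢v) ∷ []) ,
                        p1moves λ a′ v~a′ unused → ⊥-elim (leaf (a′ , v~a′ , reply≢u unused))

  unique-tallest-wins : ∀ {y₁} → Adj G v y₁ → y₁ ≢ u →
                        (∀ {y} → Adj G v y → y ≢ u → y ≢ y₁ → suc (height y) ≤ height y₁) →
                        P2WinsAgainst G u v
  unique-tallest-wins {y₁} v~y₁ y₁≢u shorter =
    outrun v~y₁ (avoids⇒unusedʳ ((y₁≢u , ≢-sym (Adj⇒≢ v~y₁)) ∷ [])) reply
    where
    v∉ : ¬ Descendant y₁ v
    v∉ = root∉branch v~y₁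

    reply : ∀ {a′} → Adj G v a′ → ¬ Used G (Opening v y₁) v a′ → Outrunning v y₁ a′
    reply {a′} v~a′ unused =
      shorter v~a′ (reply≢u unused) a′≢y₁ , branches-disjoint v~a′ v~y₁ a′≢y₁ ,
      inj₁ v∉ ∷ inj₁ v∉ ∷ inj₂ v∉ ∷ []
      where
      a′≢y₁ : a′ ≢ y₁
      a′≢y₁ refl = unused (here (inj₁ (refl , refl)))

  three-branches-wins : ∀ {y₁ y₂ y₃} → Adj G v y₁ → Adj G v y₂ → Adj G v y₃ →
                        y₁ ≢ u → y₂ ≢ u → y₃ ≢ u → y₁ ≢ y₂ → y₃ ≢ y₁ → y₃ ≢ y₂ →
                        (∀ {y} → Adj G v y → y ≢ u → height y ≤ height y₁) → height y₁ ≤ height y₂ →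
                        P2WinsAgainst G u v
  three-branches-wins {y₁} {y₂} {y₃} v~y₁ v~y₂ v~y₃ y₁≢u y₂≢u y₃≢u y₁≢y₂ y₃≢y₁ y₃≢y₂ tallest y₁≤y₂ =
    overtake (Adj-sym v~y₃) (avoids⇒unusedˡ ((y₃≢u , ≢-sym (Adj⇒≢ v~y₃)) ∷ [])) reply
    where
    via : ∀ {a′ z} → Adj G v a′ → Adj G v z → z ≢ a′ → z ≢ y₃ → z ≢ u → height a′ ≤ height z →
          Overtaking y₃ v a′
    via {z = z} v~a′ v~z z≢a′ z≢y₃ z≢u a′≤z =
      _ , v~z , (z≢v , z≢a′) ∷ (z≢y₃ , z≢v) ∷ (z≢u , z≢v) ∷ [] , a′≤z ,
      branches-disjoint v~a′ v~z (≢-sym z≢a′) ,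
      inj₁ v∉ ∷ inj₁ v∉ ∷ inj₂ v∉ ∷ inj₂ v∉ ∷ []
      where
      z≢v : z ≢ v
      z≢v = ≢-sym (Adj⇒≢ v~z)

      v∉ : ¬ Descendant z v
      v∉ = root∉branch v~z

    reply : ∀ {a′} → Adj G v a′ → ¬ Used G (Opening y₃ v) v a′ → Overtaking y₃ v a′
    reply {a′} v~a′ unused with a′ ≟ᶠ y₁
    ... | yes refl = via v~a′ v~y₂ (≢-sym y₁≢y₂) (≢-sym y₃≢y₂) y₂≢u y₁≤y₂
    ... | no a′≢y₁ = via v~a′ v~y₁ (≢-sym a′≢y₁) (≢-sym y₃≢y₁) y₁≢u (tallest v~a′ (reply≢u unused))

  tall-u-wins : ∀ {h} → suc (suc h) ≤ height u → (∀ {y} → Adj G v y → y ≢ u → height y ≤ h) →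
                P2WinsAgainst G u v
  tall-u-wins tall lower with tallest-child tall
  ... | c , u→c@(u~c , _) , h<c = outrun u~c (avoids⇒unusedʳ ((c≢u , c≢v) ∷ [])) reply
    where
    u∉ : ¬ Descendant c u
    u∉ = u∉below-u u→c

    v∉ : ¬ Descendant c v
    v∉ = v∉below-u u→c

    c≢u : c ≢ u
    c≢u = ¬descendant⇒≢ u∉

    c≢v : c ≢ v
    c≢v = ¬descendant⇒≢ v∉

    reply : ∀ {a′} → Adj G v a′ → ¬ Used G (Opening u c) v a′ → Outrunning u c a′
    reply {a′} v~a′ unused =
      ≤-trans (s≤s (lower v~a′ a′≢u)) h<c ,
      branch-disjoint-below-u v~a′ a′≢u u→c ,
      inj₁ v∉ ∷ inj₁ u∉ ∷ inj₁ u∉ ∷ []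
      where
      a′≢u : a′ ≢ u
      a′≢u = reply≢u unused

  forked-u-wins : ∀ {c₁ c₂} → Child u c₁ → Child u c₂ → c₂ ≢ c₁ →
                  (∀ {y} → Adj G v y → y ≢ u → height y ≤ height c₁) → P2WinsAgainst G u v
  forked-u-wins {c₁} {c₂} u→c₁@(u~c₁ , _) u→c₂@(u~c₂ , _) c₂≢c₁ lower =
    overtake (Adj-sym u~c₂) (avoids⇒unusedˡ ((c₂≢u , c₂≢v) ∷ [])) reply
    where
    u∉ : ¬ Descendant c₁ u
    u∉ = u∉below-u u→c₁

    v∉ : ¬ Descendant c₁ v
    v∉ = v∉below-u u→c₁

    c₁≢u : c₁ ≢ u
    c₁≢u = ¬descendant⇒≢ u∉

    c₁≢v : c₁ ≢ v
    c₁≢v = ¬descendant⇒≢ v∉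

    c₂≢u : c₂ ≢ u
    c₂≢u = ¬descendant⇒≢ (u∉below-u u→c₂)

    c₂≢v : c₂ ≢ v
    c₂≢v = ¬descendant⇒≢ (v∉below-u u→c₂)

    reply : ∀ {a′} → Adj G v a′ → ¬ Used G (Opening c₂ u) v a′ → Overtaking c₂ u a′
    reply {a′} v~a′ unused =
      c₁ , u~c₁ ,
      (c₁≢v , ¬descendant⇒≢ (below-u u→c₁ (≤-reflexive (root-neighbour-depth v~a′))))
        ∷ (≢-sym c₂≢c₁ , c₁≢u) ∷ (c₁≢u , c₁≢v) ∷ [] ,
      lower v~a′ a′≢u ,
      branch-disjoint-below-u v~a′ a′≢u u→c₁ ,
      inj₁ u∉ ∷ inj₁ v∉ ∷ inj₂ u∉ ∷ inj₁ u∉ ∷ []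
      where
      a′≢u : a′ ≢ u
      a′≢u = reply≢u unused

  u-child : ∀ {c} → Adj G u c → c ≢ v → Child u c
  u-child u~c c≢v with adj⇒child⊎parent u~c
  ... | inj₁ u→c = u→c
  ... | inj₂ c→u = ⊥-elim (c≢v (parent-unique c→u (root-neighbour-child (Adj-sym u~v))))

  u-degree-two : ∀ {c₁} → Child u c₁ → ¬ (∃[ c ] Adj G u c × c ≢ v × c ≢ c₁) → deg G u ≡ 2
  u-degree-two {c₁} u→c₁@(u~c₁ , _) no-third =
    deg≡length ((v≢c₁ ∷ []) ∷ [] ∷ []) (u~v ∷ u~c₁ ∷ []) classify
    where
    v≢c₁ : v ≢ c₁
    v≢c₁ = ≢-sym (¬descendant⇒≢ (v∉below-u u→c₁))

    classify : ∀ c → Adj G u c → c ∈ v ∷ c₁ ∷ []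
    classify c u~c with c ≟ᶠ v | c ≟ᶠ c₁
    ... | yes c≡v | _ = here c≡v
    ... | no _ | yes c≡c₁ = there (here c≡c₁)
    ... | no c≢v | no c≢c₁ = ⊥-elim (no-third (c , u~c , c≢v , c≢c₁))

  OtherNeighbour : Fin n → Set
  OtherNeighbour y = Adj G v y × y ≢ u

  otherNeighbour? : Decidable OtherNeighbour
  otherNeighbour? y = Adj? v y ×-dec ¬? (y ≟ᶠ u)

  record BalancedFork : Set where
    field
      y₁ y₂ : Fin n
      v~y₁ : Adj G v y₁
      v~y₂ : Adj G v y₂
      y₁≢u : y₁ ≢ u
      y₂≢u : y₂ ≢ u
      y₁≢y₂ : y₁ ≢ y₂
      equal-heights : height y₁ ≡ height y₂
      neighbours : ∀ y → Adj G v y → y ≡ u ⊎ y ≡ y₁ ⊎ y ≡ y₂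

  wins-or-fork : 3 ≤ n → P2WinsAgainst G u v ⊎ BalancedFork
  wins-or-fork 3≤n with any? otherNeighbour?
  ... | no leaf = inj₁ (leaf-root-wins 3≤n leaf)
  ... | yes (_ , other) = from-tallest (argmax-Fin otherNeighbour? height other)
    where
    from-tallest : Σ[ y₁ ∈ Fin n ] OtherNeighbour y₁ × (∀ y → OtherNeighbour y → height y ≤ height y₁) →
                   P2WinsAgainst G u v ⊎ BalancedFork
    from-tallest (y₁ , (v~y₁ , y₁≢u) , tallest)
      with any? (λ y → otherNeighbour? y ×-dec ¬? (y ≟ᶠ y₁) ×-dec (height y₁ ≤? height y))
    ... | no unique = inj₁ (unique-tallest-wins v~y₁ y₁≢u λ v~y y≢u y≢y₁ →
                              ≰⇒> λ y₁≤y → unique (_ , (v~y , y≢u) , y≢y₁ , y₁≤y))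
    ... | yes (y₂ , (v~y₂ , y₂≢u) , y₂≢y₁ , y₁≤y₂)
      with any? (λ y → otherNeighbour? y ×-dec ¬? (y ≟ᶠ y₁) ×-dec ¬? (y ≟ᶠ y₂))
    ...   | yes (y₃ , (v~y₃ , y₃≢u) , y₃≢y₁ , y₃≢y₂) =
      inj₁ (three-branches-wins v~y₁ v~y₂ v~y₃ y₁≢u y₂≢u y₃≢u (≢-sym y₂≢y₁) y₃≢y₁ y₃≢y₂
              (λ v~y y≢u → tallest _ (v~y , y≢u)) y₁≤y₂)
    ...   | no no-third = inj₂ record
      { y₁ = y₁ ; y₂ = y₂ ; v~y₁ = v~y₁ ; v~y₂ = v~y₂
      ; y₁≢u = y₁≢u ; y₂≢u = y₂≢u ; y₁≢y₂ = ≢-sym y₂≢y₁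
      ; equal-heights = ≤-antisym y₁≤y₂ (tallest y₂ (v~y₂ , y₂≢u))
      ; neighbours = classify
      }
      where
      classify : ∀ y → Adj G v y → y ≡ u ⊎ y ≡ y₁ ⊎ y ≡ y₂
      classify y v~y with y ≟ᶠ u | y ≟ᶠ y₁ | y ≟ᶠ y₂
      ... | yes y≡u | _ | _ = inj₁ y≡u
      ... | no _ | yes y≡y₁ | _ = inj₂ (inj₁ y≡y₁)
      ... | no _ | no _ | yes y≡y₂ = inj₂ (inj₂ y≡y₂)
      ... | no y≢u | no y≢y₁ | no y≢y₂ = ⊥-elim (no-third (y , (v~y , y≢u) , y≢y₁ , y≢y₂))

  module Fork (fork : BalancedFork) where
    open BalancedFork fork

    other-height≤ : ∀ {y} → Adj G v y → y ≢ u → height y ≤ height y₁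
    other-height≤ v~y y≢u with neighbours _ v~y
    ... | inj₁ y≡u = ⊥-elim (y≢u y≡u)
    ... | inj₂ (inj₁ refl) = ≤-refl
    ... | inj₂ (inj₂ refl) = ≤-reflexive (sym equal-heights)

    neighbour-height≤ : ∀ {t} → Adj G v t → height t ≤ height y₁ ⊔ height u
    neighbour-height≤ {t} v~t with t ≟ᶠ u
    ... | yes refl = m≤n⊔m (height y₁) (height t)
    ... | no t≢u = ≤-trans (other-height≤ v~t t≢u) (m≤m⊔n (height y₁) (height u))

    depth≤ : ∀ x → depth x ≤ suc (height y₁ ⊔ height u)
    depth≤ x with x ≟ᶠ v
    ... | yes refl = ≤-trans (≤-reflexive depth-root) z≤n
    ... | no x≢v with branch x x≢v
    ...   | t , v~t , t→x = begin
      depth x              ≤⟨ descendant-depth≤ t→x ⟩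
      height t + depth t   ≡⟨ height+depth-branch v~t ⟩
      suc (height t)       ≤⟨ s≤s (neighbour-height≤ v~t) ⟩
      suc (height y₁ ⊔ height u) ∎
      where open ≤-Reasoning

    deg-root≡3 : deg G v ≡ 3
    deg-root≡3 = deg≡length
      ((≢-sym y₁≢u ∷ ≢-sym y₂≢u ∷ []) ∷ (y₁≢y₂ ∷ []) ∷ [] ∷ [])
      (Adj-sym u~v ∷ v~y₁ ∷ v~y₂ ∷ [])
      (λ y v~y → [ here , [ there ∘ here , there ∘ there ∘ here ]′ ]′ (neighbours y v~y))

    -- Whichever branch t a vertex lies in, one of the two equal branches y₁, y₂ avoids t.
    fork-root-central : height u ≤ suc (height y₁) → Central G v
    fork-root-central u≤ = root-central escape
      where
      deepest-elsewhere : ∀ {t y} → Adj G v t → Adj G v y → t ≢ y → height y ≡ height y₁ →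
                          Σ[ z ∈ Fin n ] ¬ Descendant t z × depth far ≤ suc (depth z)
      deepest-elsewhere v~t v~y t≢y hy with deepest-in-branch v~y
      ... | z , y→z , dz = z , (λ t→z → branches-disjoint v~t v~y t≢y _ t→z y→z) , (begin
        depth far                  ≤⟨ depth≤ far ⟩
        suc (height y₁ ⊔ height u) ≤⟨ s≤s (⊔-lub (n≤1+n _) u≤) ⟩
        suc (suc (height y₁))      ≡⟨ cong (λ h → suc (suc h)) (sym hy) ⟩
        suc (suc (height _))       ≡⟨ cong suc (sym dz) ⟩
        suc (depth z)              ∎)
        where open ≤-Reasoning

      escape : ∀ {t} → Adj G v t → Σ[ z ∈ Fin n ] ¬ Descendant t z × depth far ≤ suc (depth z)
      escape {t} v~t with t ≟ᶠ y₁
      ... | yes refl = deepest-elsewhere v~t v~y₂ y₁≢y₂ (sym equal-heights)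
      ... | no t≢y₁ = deepest-elsewhere v~t v~y₁ t≢y₁ refl

    u-not-central : Central G u → Central G v → height u ≤ height y₁ → ⊥
    u-not-central (eu , ecc-u , minimal-u) (ev , ecc-v , _) u≤y₁ with deepest-in-branch v~y₁
    ... | z , y₁→z , dz = 1+n≰n (begin
      suc (suc (height y₁)) ≡⟨ sym (cong₂ _+_ u-depth dz) ⟩
      depth u + depth z     ≤⟨ ecc-≥ ecc-u z (leave-branch descendant-refl (Adj-sym u~v) z∉u) ⟩
      eu                    ≤⟨ minimal-u v ev ecc-v ⟩
      ev                    ≤⟨ root-ecc-≤ ecc-v (λ x → ≤-trans (depth≤ x) (s≤s (⊔-lub ≤-refl u≤y₁))) ⟩
      suc (height y₁)       ∎)
      where
      open ≤-Reasoning
      z∉u : ¬ Descendant u z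
      z∉u u→z = branches-disjoint v~y₁ (Adj-sym u~v) y₁≢u _ y₁→z u→z

    wins-unless-central-of-degree-3 : ¬ (Central G v × deg G v ≡ 3) → P2WinsAgainst G u v
    wins-unless-central-of-degree-3 ¬central₃ with suc (suc (height y₁)) ≤? height u
    ... | yes tall = tall-u-wins tall other-height≤
    ... | no short = ⊥-elim (¬central₃ (fork-root-central (≤-pred (≰⇒> short)) , deg-root≡3))

    wins-if-both-central : Central G u → Central G v → deg G u ≢ 2 → P2WinsAgainst G u v
    wins-if-both-central central-u central-v deg≢2 with suc (height y₁) ≤? height u
    ... | no short = ⊥-elim (u-not-central central-u central-v (≤-pred (≰⇒> short)))
    ... | yes tall with tallest-child tall
    ...   | c₁ , u→c₁ , y₁≤c₁ with any? (λ c → Adj? u c ×-dec ¬? (c ≟ᶠ v) ×-dec ¬? (c ≟ᶠ c₁))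
    ...     | yes (c₂ , u~c₂ , c₂≢v , c₂≢c₁) =
      forked-u-wins u→c₁ (u-child u~c₂ c₂≢v) c₂≢c₁
        (λ v~y y≢u → ≤-trans (other-height≤ v~y y≢u) y₁≤c₁)
    ...     | no no-third = ⊥-elim (deg≢2 (u-degree-two u→c₁ no-third))

lemma4p4 : (n : ℕ) (G : Graph n) → IsTree G → 3 ≤ n → (u v : Fin n) → Adj G u v →
    (¬ (Central G v × deg G v ≡ 3) → P2WinsAgainst G u v)
    × (Central G u → Central G v → deg G u ≢ 2 → P2WinsAgainst G u v)
lemma4p4 n G tree 3≤n u v u~v =
  (λ ¬central₃ →
     [ id , (λ fork → Fork.wins-unless-central-of-degree-3 fork ¬central₃) ]′ (wins-or-fork 3≤n)) ,
  (λ central-u central-v deg≢2 →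
     [ id , (λ fork → Fork.wins-if-both-central fork central-u central-v deg≢2) ]′ (wins-or-fork 3≤n))
  where
  open FirstMove G tree u~v
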